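{- Let $\sigma_1=(a_1,\dots,a_m)$, $\sigma_2=(b_1,\dots,b_n)$, $\sigma_3=(c_1,\dots,c_l)$ be three nonincreasing sequences of nonnegative integers, and put $\mu=\frac12\left(\sum_{j=1}^{n}b_j+\sum_{k=1}^{l}c_k-\sum_{i=1}^{m}a_i\right)$. If there exists a simple tripartite graph $G$ with vertex classes $\{x_1,\dots,x_m\}$, $\{y_1,\dots,y_n\}$, $\{z_1,\dots,z_l\}$ such that $d_G(x_i)=a_i$, $d_G(y_j)=b_j$, $d_G(z_k)=c_k$ for all $i,j,k$, then for each $\delta$ with $1\le\delta\le m$, $$\sum_{i=1}^{\delta}a_i\le\min\Big\{\sum_{j=1}^{n}b_j-\mu,\;n\delta\Big\}+\min\Big\{\sum_{k=1}^{l}c_k-\mu,\;l\delta\Big\}.$$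
   Context: A tripartite graph is a simple graph whose vertex set is partitioned into three classes with no edge joining two vertices of the same class. $d_G(v)$ denotes the degree of $v$ in $G$. -}

module Defs where

open import Data.Nat using (ℕ; zero; suc; _+_; _≤_)
open import Data.Fin using (Fin; zero; suc; inject≤)
open import Data.Bool using (Bool; if_then_else_)

sumF : ∀ {n} → (Fin n → ℕ) → ℕ
sumF {zero}  f = 0
sumF {suc n} f = f zero + sumF (λ i → f (suc i))

prefixSum : ∀ {m} (a : Fin m → ℕ) (δ : ℕ) → δ ≤ m → ℕ
prefixSum a δ δ≤m = sumF {δ} (λ i → a (inject≤ i δ≤m))

Nonincreasing : ∀ {m} → (Fin m → ℕ) → Set
Nonincreasing {m} a = ∀ (i j : Fin m) → Data.Fin._≤_ i j → a j ≤ a i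

-- A simple tripartite graph with vertex classes X = {x_i : i < m},
-- Y = {y_j : j < n}, Z = {z_k : k < l}: adjacency is only between
-- different classes, at most one edge per pair (Bool adjacency).
record Tripartite (m n l : ℕ) : Set where
  field
    xy : Fin m → Fin n → Bool
    xz : Fin m → Fin l → Bool
    yz : Fin n → Fin l → Bool

ind : Bool → ℕ
ind b = if b then 1 else 0

module _ {m n l : ℕ} (G : Tripartite m n l) where
  open Tripartite G
  degX : Fin m → ℕ
  degX i = sumF (λ j → ind (xy i j)) + sumF (λ k → ind (xz i k))
  degY : Fin n → ℕ
  degY j = sumF (λ i → ind (xy i j)) + sumF (λ k → ind (yz j k))
  degZ : Fin l → ℕ
  degZ k = sumF (λ i → ind (xz i k)) + sumF (λ j → ind (yz j k))

{-# OPTIONS --safe #-}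
module Submission where

-- Let e_XY, e_XZ, e_YZ count the edges between the three pairs of classes.
-- Summing degrees over each class gives A = e_XY + e_XZ, B = e_XY + e_YZ and
-- C = e_XZ + e_YZ, so 2μ = 2 e_YZ, B − μ = e_XY and C − μ = e_XZ.  The degree
-- of x_i splits into its Y-part and its Z-part; over the first δ vertices of X
-- the Y-parts add up to at most e_XY and, each being at most n, to at most nδ;
-- likewise the Z-parts are bounded by e_XZ and lδ.

open import Defs
open import Data.Nat using (ℕ; _≤_)
open import Data.Fin using (Fin)
open import Data.Integer using (ℤ; +_; _+_; _-_; _*_; _⊓_)
open import Data.Product using (∃; _×_)
open import Relation.Binary.PropositionalEquality using (_≡_)

open import Data.Bool using (Bool; true; false)
open import Data.Fin using (inject≤) renaming (zero to fzero; suc to fsuc)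
import Data.Integer as ℤ
import Data.Integer.Properties as ℤP
open import Data.Integer.Tactic.RingSolver using (solve-∀)
open import Data.Nat as ℕ using (zero; suc; z≤n; s≤s)
import Data.Nat.Properties as NP
open import Algebra.Properties.CommutativeMonoid.Sum NP.+-0-commutativeMonoid
  using (sum; sum-cong-≗; ∑-distrib-+; ∑-comm)
open import Data.Product using (_,_)
open import Relation.Binary.PropositionalEquality
  using (refl; sym; trans; cong; cong₂; module ≡-Reasoning)

sumF≡sum : ∀ {n} (f : Fin n → ℕ) → sumF f ≡ sum f
sumF≡sum {zero}  f = refl
sumF≡sum {suc n} f = cong (f fzero ℕ.+_) (sumF≡sum (λ i → f (fsuc i)))

sumF-cong : ∀ {n} {f g : Fin n → ℕ} → (∀ i → f i ≡ g i) → sumF f ≡ sumF g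
sumF-cong {f = f} {g} f≗g = begin
  sumF f ≡⟨ sumF≡sum f ⟩
  sum f  ≡⟨ sum-cong-≗ f≗g ⟩
  sum g  ≡⟨ sumF≡sum g ⟨
  sumF g ∎
  where open ≡-Reasoning

sumF-distrib-+ : ∀ {n} (f g : Fin n → ℕ) →
                 sumF (λ i → f i ℕ.+ g i) ≡ sumF f ℕ.+ sumF g
sumF-distrib-+ f g = begin
  sumF (λ i → f i ℕ.+ g i) ≡⟨ sumF≡sum (λ i → f i ℕ.+ g i) ⟩
  sum (λ i → f i ℕ.+ g i)  ≡⟨ ∑-distrib-+ f g ⟩
  sum f ℕ.+ sum g          ≡⟨ cong₂ ℕ._+_ (sumF≡sum f) (sumF≡sum g) ⟨
  sumF f ℕ.+ sumF g        ∎
  where open ≡-Reasoning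

sumF-comm : ∀ {m n} (f : Fin m → Fin n → ℕ) →
            sumF (λ i → sumF (f i)) ≡ sumF (λ j → sumF (λ i → f i j))
sumF-comm f = begin
  sumF (λ i → sumF (f i))          ≡⟨ sumF≡sum (λ i → sumF (f i)) ⟩
  sum (λ i → sumF (f i))           ≡⟨ sum-cong-≗ (λ i → sumF≡sum (f i)) ⟩
  sum (λ i → sum (f i))            ≡⟨ ∑-comm f ⟩
  sum (λ j → sum (λ i → f i j))    ≡⟨ sum-cong-≗ (λ j → sumF≡sum (λ i → f i j)) ⟨
  sum (λ j → sumF (λ i → f i j))   ≡⟨ sumF≡sum (λ j → sumF (λ i → f i j)) ⟨
  sumF (λ j → sumF (λ i → f i j))  ∎
  where open ≡-Reasoning

sumF-≤-* : ∀ {n} (f : Fin n → ℕ) {k} → (∀ i → f i ≤ k) → sumF f ≤ n ℕ.* k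
sumF-≤-* {zero}  f f≤k = z≤n
sumF-≤-* {suc n} f f≤k = NP.+-mono-≤ (f≤k fzero) (sumF-≤-* (λ i → f (fsuc i)) (λ i → f≤k (fsuc i)))

sumF-ind≤ : ∀ {n} (g : Fin n → Bool) → sumF (λ i → ind (g i)) ≤ n
sumF-ind≤ {zero}  g = z≤n
sumF-ind≤ {suc n} g = NP.+-mono-≤ (ind≤1 (g fzero)) (sumF-ind≤ (λ i → g (fsuc i)))
  where
  ind≤1 : ∀ b → ind b ≤ 1
  ind≤1 true  = s≤s z≤n
  ind≤1 false = z≤n

prefixSum≤sumF : ∀ {m} (f : Fin m → ℕ) δ (δ≤m : δ ≤ m) → prefixSum f δ δ≤m ≤ sumF f
prefixSum≤sumF f       zero    δ≤m       = z≤n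
prefixSum≤sumF {suc m} f (suc δ) (s≤s δ≤m) =
  NP.+-monoʳ-≤ (f fzero) (prefixSum≤sumF (λ i → f (fsuc i)) δ δ≤m)

module _ {m n l : ℕ} (G : Tripartite m n l) where
  open Tripartite G

  xyDegree xzDegree : Fin m → ℕ
  xyDegree i = sumF (λ j → ind (xy i j))
  xzDegree i = sumF (λ k → ind (xz i k))

  yxDegree yzDegree : Fin n → ℕ
  yxDegree j = sumF (λ i → ind (xy i j))
  yzDegree j = sumF (λ k → ind (yz j k))

  zxDegree zyDegree : Fin l → ℕ
  zxDegree k = sumF (λ i → ind (xz i k))
  zyDegree k = sumF (λ j → ind (yz j k))

  xyEdges xzEdges yzEdges : ℕ
  xyEdges = sumF xyDegree
  xzEdges = sumF xzDegree
  yzEdges = sumF yzDegree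

  sumF-degX : ∀ {a : Fin m → ℕ} → (∀ i → degX G i ≡ a i) → sumF a ≡ xyEdges ℕ.+ xzEdges
  sumF-degX degX≡a = trans (sym (sumF-cong degX≡a)) (sumF-distrib-+ xyDegree xzDegree)

  sumF-degY : ∀ {b : Fin n → ℕ} → (∀ j → degY G j ≡ b j) → sumF b ≡ xyEdges ℕ.+ yzEdges
  sumF-degY {b} degY≡b = begin
    sumF b                         ≡⟨ sumF-cong degY≡b ⟨
    sumF (degY G)                  ≡⟨ sumF-distrib-+ yxDegree yzDegree ⟩
    sumF yxDegree ℕ.+ yzEdges      ≡⟨ cong (ℕ._+ yzEdges) (sumF-comm (λ i j → ind (xy i j))) ⟨
    xyEdges ℕ.+ yzEdges            ∎
    where open ≡-Reasoning

  sumF-degZ : ∀ {c : Fin l → ℕ} → (∀ k → degZ G k ≡ c k) → sumF c ≡ xzEdges ℕ.+ yzEdges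
  sumF-degZ {c} degZ≡c = begin
    sumF c                         ≡⟨ sumF-cong degZ≡c ⟨
    sumF (degZ G)                  ≡⟨ sumF-distrib-+ zxDegree zyDegree ⟩
    sumF zxDegree ℕ.+ sumF zyDegree ≡⟨ cong₂ ℕ._+_ (sumF-comm (λ i k → ind (xz i k)))
                                                   (sumF-comm (λ j k → ind (yz j k))) ⟨
    xzEdges ℕ.+ yzEdges            ∎
    where open ≡-Reasoning

  prefixSum-degX : ∀ {a : Fin m → ℕ} → (∀ i → degX G i ≡ a i) → ∀ δ (δ≤m : δ ≤ m) →
    prefixSum a δ δ≤m ≡ prefixSum xyDegree δ δ≤m ℕ.+ prefixSum xzDegree δ δ≤m
  prefixSum-degX degX≡a δ δ≤m =
    trans (sym (sumF-cong (λ i → degX≡a (inject≤ i δ≤m))))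
          (sumF-distrib-+ (λ i → xyDegree (inject≤ i δ≤m)) (λ i → xzDegree (inject≤ i δ≤m)))

  prefixSum-xyDegree≤ : ∀ δ (δ≤m : δ ≤ m) → prefixSum xyDegree δ δ≤m ≤ n ℕ.* δ
  prefixSum-xyDegree≤ δ δ≤m = NP.≤-trans
    (sumF-≤-* (λ i → xyDegree (inject≤ i δ≤m)) (λ i → sumF-ind≤ (xy (inject≤ i δ≤m))))
    (NP.≤-reflexive (NP.*-comm δ n))

  prefixSum-xzDegree≤ : ∀ δ (δ≤m : δ ≤ m) → prefixSum xzDegree δ δ≤m ≤ l ℕ.* δ
  prefixSum-xzDegree≤ δ δ≤m = NP.≤-trans
    (sumF-≤-* (λ i → xzDegree (inject≤ i δ≤m)) (λ i → sumF-ind≤ (xz (inject≤ i δ≤m))))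
    (NP.≤-reflexive (NP.*-comm δ l))

-- p, q, r play the roles of e_XY, e_XZ, e_YZ.
twice-sum≤min+min : ∀ (s t p q r u v : ℤ) → s ℤ.≤ p → s ℤ.≤ u → t ℤ.≤ q → t ℤ.≤ v →
  + 2 * (s + t) ℤ.≤ (+ 2 * (p + r) - ((p + r) + (q + r) - (p + q))) ⊓ (+ 2 * u)
                  + (+ 2 * (q + r) - ((p + r) + (q + r) - (p + q))) ⊓ (+ 2 * v)
twice-sum≤min+min s t p q r u v s≤p s≤u t≤q t≤v = begin
  + 2 * (s + t)                                 ≡⟨ ℤP.*-distribˡ-+ (+ 2) s t ⟩
  + 2 * s + + 2 * t                             ≤⟨ ℤP.+-mono-≤ (ℤP.⊓-glb (twice-mono s≤p) (twice-mono s≤u))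
                                                               (ℤP.⊓-glb (twice-mono t≤q) (twice-mono t≤v)) ⟩
  (+ 2 * p) ⊓ (+ 2 * u) + (+ 2 * q) ⊓ (+ 2 * v) ≡⟨ cong₂ (λ x y → x ⊓ (+ 2 * u) + y ⊓ (+ 2 * v))
                                                         (sym (B-μ p q r)) (sym (C-μ p q r)) ⟩
  (+ 2 * (p + r) - twoμ) ⊓ (+ 2 * u) + (+ 2 * (q + r) - twoμ) ⊓ (+ 2 * v) ∎
  where
  open ℤP.≤-Reasoning
  twoμ : ℤ
  twoμ = (p + r) + (q + r) - (p + q)
  twice-mono : ∀ {i j} → i ℤ.≤ j → + 2 * i ℤ.≤ + 2 * j
  twice-mono = ℤP.*-monoˡ-≤-nonNeg (+ 2)
  B-μ : ∀ p q r → + 2 * (p + r) - ((p + r) + (q + r) - (p + q)) ≡ + 2 * p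
  B-μ = solve-∀
  C-μ : ∀ p q r → + 2 * (q + r) - ((p + r) + (q + r) - (p + q)) ≡ + 2 * q
  C-μ = solve-∀

theorem2p5 : (m n l : ℕ) (a : Fin m → ℕ) (b : Fin n → ℕ) (c : Fin l → ℕ) →
    Nonincreasing a → Nonincreasing b → Nonincreasing c →
    (∃ λ (G : Tripartite m n l) →
      (∀ i → degX G i ≡ a i) × (∀ j → degY G j ≡ b j) × (∀ k → degZ G k ≡ c k)) →
    (δ : ℕ) (1≤δ : 1 ≤ δ) (δ≤m : δ ≤ m) →
    let A = + sumF a
        B = + sumF b
        C = + sumF c
        twoμ = B + C - A
    in + 2 * + prefixSum a δ δ≤m
       Data.Integer.≤ ((+ 2 * B - twoμ) ⊓ (+ 2 * (+ n * + δ)))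
                      + ((+ 2 * C - twoμ) ⊓ (+ 2 * (+ l * + δ)))
theorem2p5 m n l a b c _ _ _ (G , degX≡a , degY≡b , degZ≡c) δ _ δ≤m
  rewrite sumF-degX G degX≡a | sumF-degY G degY≡b | sumF-degZ G degZ≡c
        | prefixSum-degX G degX≡a δ δ≤m
        | ℤP.pos-+ (xyEdges G) (xzEdges G) | ℤP.pos-+ (xyEdges G) (yzEdges G)
        | ℤP.pos-+ (xzEdges G) (yzEdges G)
        | ℤP.pos-+ (prefixSum (xyDegree G) δ δ≤m) (prefixSum (xzDegree G) δ δ≤m)
  = twice-sum≤min+min _ _ _ _ (+ yzEdges G) _ _
      (ℤ.+≤+ (prefixSum≤sumF (xyDegree G) δ δ≤m))
      (ℤP.≤-trans (ℤ.+≤+ (prefixSum-xyDegree≤ G δ δ≤m)) (ℤP.≤-reflexive (ℤP.pos-* n δ)))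
      (ℤ.+≤+ (prefixSum≤sumF (xzDegree G) δ δ≤m))
      (ℤP.≤-trans (ℤ.+≤+ (prefixSum-xzDegree≤ G δ δ≤m)) (ℤP.≤-reflexive (ℤP.pos-* l δ)))
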